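{- Let $\mathbb S_2=\{(r,s)\in\mathbb Q^2: 0<r<s<3/2,\ r\ne1,\ s\ne\frac12,\ 24s\in\mathbb Z,\ 8(r+s)\in\mathbb Z\}$. For $D\in\{24,12,8,6,4,3\}$ let $$O(D)=\left\{\left(\tfrac iD,\ \tfrac{D-i}{D}+\left\lfloor\tfrac{2i}{D}\right\rfloor\right): 1\le i\le D-1,\ \gcd(i,D)=1\right\}.$$ Then a pair $(r,s)\in\mathbb S_2$ belongs to $O(D)$ for some $D\in\{24,12,8,6,4,3\}$ if and only if $r+s=1$ or $r+s=2$.
   Context: The sets $O(D)$ are the orbits of the pairs $(\frac{j}{24},\frac{24-j}{24})$, $1\le j\le 11$, with $D=24/\gcd(j,24)$. -}

module Defs where

open import Data.Nat as ℕ using (ℕ; NonZero; _∸_; _≤_)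
open import Data.Nat.GCD using (gcd)
open import Data.Integer as ℤ using (ℤ; +_)
open import Data.Rational using (ℚ; _/_; _+_; _*_; _<_; 0ℚ; 1ℚ; ½)
open import Data.Product using (∃-syntax; _×_)
open import Data.Sum using (_⊎_)
open import Relation.Binary.PropositionalEquality using (_≡_; _≢_)

IsInt : ℚ → Set
IsInt q = ∃[ z ] q ≡ z / 1

ℕ→ℚ : ℕ → ℚ
ℕ→ℚ n = + n / 1

S₂ : ℚ → ℚ → Set
S₂ r s =
  (0ℚ < r) × (r < s) × (s < + 3 / 2) × (r ≢ 1ℚ) × (s ≢ ½)
  × IsInt (ℕ→ℚ 24 * s) × IsInt (ℕ→ℚ 8 * (r + s))

InO : (D : ℕ) → .{{_ : NonZero D}} → ℚ → ℚ → Set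
InO D r s = ∃[ i ]
  (1 ≤ i) × (i ≤ D ∸ 1) × (gcd i D ≡ 1)
  × (r ≡ + i / D)
  × (s ≡ (+ (D ∸ i) / D) + ℕ→ℚ ((2 ℕ.* i) ℕ./ D))

InSomeO : ℚ → ℚ → Set
InSomeO r s = InO 24 r s ⊎ InO 12 r s ⊎ InO 8 r s ⊎ InO 6 r s ⊎ InO 4 r s ⊎ InO 3 r s

-- If 1 ≤ i < D then i/D + (D − i)/D + ⌊2i/D⌋ = 1 + ⌊2i/D⌋ with ⌊2i/D⌋ ∈ {0, 1},
-- so every O(D) lies on the lines r + s = 1 and r + s = 2. Conversely, let (r, s) ∈ 𝕊₂ with
-- r + s = c ∈ {1, 2}. Since 24s ∈ ℤ we have s = n/24 and r = j/24 with j + n = 24c, and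
-- 0 < r < s < 3/2 means 0 < j < n < 36. This forces 0 < j < 12 if c = 1 and 12 < j < 24 if
-- c = 2; in both cases c = 1 + ⌊2j/24⌋, so s = (24 − j)/24 + ⌊2j/24⌋. Writing j/24 in lowest
-- terms i/D, D = 24/gcd(j, 24), puts (r, s) in O(D), and j ≠ 12 rules out D = 2.
module Submission where

open import Defs
open import Data.Rational using (ℚ; _+_; 1ℚ)
open import Data.Sum using (_⊎_)
open import Data.Product using (_×_)
open import Relation.Binary.PropositionalEquality using (_≡_; _≢_)

open import Data.Integer as ℤ using (+_; -[1+_]; 0ℤ)
import Data.Integer.Properties as ℤ
import Data.Integer.Solver as ℤ-Solver
open import Data.List using (List; []; _∷_)
open import Data.List.Relation.Unary.Any using (here; there)
open import Data.Nat as ℕ using (ℕ; suc; _∸_; _≤_; s≤s)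
open import Data.Nat.Coprimality using (coprime⇒gcd≡1; coprime-/gcd)
open import Data.Nat.Divisibility using (∣⇒≤)
open import Data.Nat.DivMod using (m/n*n≡m; m<n*o⇒m/o<n; m≥n⇒m/n>0; /-congˡ; /-congʳ; m*n/o*n≡m/o)
open import Data.Nat.GCD using (gcd; gcd[m,n]∣m; gcd[m,n]∣n; gcd[m,n]≢0; n/gcd[m,n]≢0)
import Data.Nat.Properties as ℕ
import Data.Nat.Solver as ℕ-Solver
open import Data.List.Membership.DecPropositional ℕ._≟_ using (_∈_; _∈?_)
open import Data.Product using (∃-syntax; ∃₂; _,_)
open import Data.Rational using (_/_; _*_; _<_; 0ℚ; toℚᵘ)
open import Data.Rational.Properties
  using ( toℚᵘ-injective; toℚᵘ-fromℚᵘ; fromℚᵘ-cong; toℚᵘ-homo-+; toℚᵘ-homo-*; toℚᵘ-mono-<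
        ; /-cong; 0/n≡0; +-assoc; +-identityˡ; +-monoˡ-<; *-assoc; *-comm; *-identityˡ; <-trans
        ; +-0-group)
open import Data.Rational.Unnormalised as ℚᵘ using (*≡*) renaming (_/_ to _/ᵘ_; _≃_ to _≃ᵘ_)
import Data.Rational.Unnormalised.Properties as ℚᵘ
open import Algebra.Properties.Group +-0-group using (∙-cancelˡ; ∙-cancelʳ)
open import Data.Sum using (inj₁; inj₂)
import Data.Sum as Sum
open import Function using (_∘_)
open import Relation.Binary.PropositionalEquality
  using (refl; sym; trans; cong; cong₂; subst; subst₂; module ≡-Reasoning)
open import Relation.Nullary using (Dec; ¬?; contradiction)
open import Relation.Nullary.Decidable using (toWitness; _→-dec_)

toℚᵘ-/ : ∀ a d .{{_ : ℕ.NonZero d}} → toℚᵘ (a / d) ≃ᵘ a /ᵘ d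
toℚᵘ-/ a (suc d) = toℚᵘ-fromℚᵘ (a /ᵘ suc d)

a*e≡b*d⇒a/d≡b/e : ∀ a b d e .{{_ : ℕ.NonZero d}} .{{_ : ℕ.NonZero e}} →
                  a ℤ.* + e ≡ b ℤ.* + d → a / d ≡ b / e
a*e≡b*d⇒a/d≡b/e a b d@(suc _) e@(suc _) eq = fromℚᵘ-cong {a /ᵘ d} {b /ᵘ e} (*≡* eq)

m*e≡n*d⇒m/d≡n/e : ∀ m n d e .{{_ : ℕ.NonZero d}} .{{_ : ℕ.NonZero e}} →
                  m ℕ.* e ≡ n ℕ.* d → + m / d ≡ + n / e
m*e≡n*d⇒m/d≡n/e m n d e eq =
  a*e≡b*d⇒a/d≡b/e (+ m) (+ n) d e (trans (sym (ℤ.pos-* m e)) (trans (cong +_ eq) (ℤ.pos-* n d)))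

n/n≡1 : ∀ n .{{_ : ℕ.NonZero n}} → + n / n ≡ 1ℚ
n/n≡1 n = m*e≡n*d⇒m/d≡n/e n 1 n 1 (ℕ.*-comm n 1)

a/d+b/d≡[a+b]/d : ∀ a b d .{{_ : ℕ.NonZero d}} → a / d + b / d ≡ (a ℤ.+ b) / d
a/d+b/d≡[a+b]/d a b d@(suc _) = toℚᵘ-injective (begin
  toℚᵘ (a / d + b / d)            ≈⟨ toℚᵘ-homo-+ (a / d) (b / d) ⟩
  toℚᵘ (a / d) ℚᵘ.+ toℚᵘ (b / d)  ≈⟨ ℚᵘ.+-cong (toℚᵘ-/ a d) (toℚᵘ-/ b d) ⟩
  a /ᵘ d ℚᵘ.+ b /ᵘ d              ≈⟨ *≡* cross ⟩
  (a ℤ.+ b) /ᵘ d                  ≈⟨ ℚᵘ.≃-sym (toℚᵘ-/ (a ℤ.+ b) d) ⟩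
  toℚᵘ ((a ℤ.+ b) / d)            ∎)
  where
  open ℚᵘ.≃-Reasoning
  cross : (a ℤ.* + d ℤ.+ b ℤ.* + d) ℤ.* + d ≡ (a ℤ.+ b) ℤ.* + (d ℕ.* d)
  cross = trans
    (solve 3 (λ a b d → (a :* d :+ b :* d) :* d := (a :+ b) :* (d :* d)) refl a b (+ d))
    (cong ((a ℤ.+ b) ℤ.*_) (sym (ℤ.pos-* d d)))
    where open ℤ-Solver.+-*-Solver

a/1*b/d≡[a*b]/d : ∀ a b d .{{_ : ℕ.NonZero d}} → a / 1 * (b / d) ≡ (a ℤ.* b) / d
a/1*b/d≡[a*b]/d a b d@(suc _) = toℚᵘ-injective (begin
  toℚᵘ (a / 1 * (b / d))          ≈⟨ toℚᵘ-homo-* (a / 1) (b / d) ⟩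
  toℚᵘ (a / 1) ℚᵘ.* toℚᵘ (b / d)  ≈⟨ ℚᵘ.*-cong (toℚᵘ-/ a 1) (toℚᵘ-/ b d) ⟩
  (a /ᵘ 1) ℚᵘ.* (b /ᵘ d)          ≈⟨ *≡* (cong ((a ℤ.* b) ℤ.*_) (cong +_ (sym (ℕ.*-identityˡ d)))) ⟩
  (a ℤ.* b) /ᵘ d                  ≈⟨ ℚᵘ.≃-sym (toℚᵘ-/ (a ℤ.* b) d) ⟩
  toℚᵘ ((a ℤ.* b) / d)            ∎)
  where open ℚᵘ.≃-Reasoning

a/d<b/d⇒a<b : ∀ a b d .{{_ : ℕ.NonZero d}} → a / d < b / d → a ℤ.< b
a/d<b/d⇒a<b a b d@(suc _) a/d<b/d = ℤ.*-cancelʳ-<-nonNeg (+ d) (ℚᵘ.drop-*<*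
  (ℚᵘ.<-respˡ-≃ (toℚᵘ-/ a d) (ℚᵘ.<-respʳ-≃ (toℚᵘ-/ b d) (toℚᵘ-mono-< a/d<b/d))))

ℕ→ℚ≡[m*d]/d : ∀ m d .{{_ : ℕ.NonZero d}} → ℕ→ℚ m ≡ + (m ℕ.* d) / d
ℕ→ℚ≡[m*d]/d m d = m*e≡n*d⇒m/d≡n/e m (m ℕ.* d) 1 d (sym (ℕ.*-identityʳ (m ℕ.* d)))

d*s≡z⇒s≡z/d : ∀ d .{{_ : ℕ.NonZero d}} {s z} → ℕ→ℚ d * s ≡ z / 1 → s ≡ z / d
d*s≡z⇒s≡z/d d {s} {z} d*s≡z = begin
  s                      ≡⟨ sym (*-identityˡ s) ⟩
  1ℚ * s                 ≡⟨ cong (_* s) (sym [1/d]*d≡1) ⟩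
  + 1 / d * ℕ→ℚ d * s    ≡⟨ *-assoc (+ 1 / d) (ℕ→ℚ d) s ⟩
  + 1 / d * (ℕ→ℚ d * s)  ≡⟨ cong (+ 1 / d *_) d*s≡z ⟩
  + 1 / d * (z / 1)      ≡⟨ *-comm (+ 1 / d) (z / 1) ⟩
  z / 1 * (+ 1 / d)      ≡⟨ a/1*b/d≡[a*b]/d z (+ 1) d ⟩
  (z ℤ.* + 1) / d        ≡⟨ /-cong (ℤ.*-identityʳ z) refl ⟩
  z / d                  ∎
  where
  open ≡-Reasoning
  [1/d]*d≡1 : + 1 / d * ℕ→ℚ d ≡ 1ℚ
  [1/d]*d≡1 = trans (*-comm (+ 1 / d) (ℕ→ℚ d))
    (trans (a/1*b/d≡[a*b]/d (+ d) (+ 1) d) (trans (/-cong (ℤ.*-identityʳ (+ d)) refl) (n/n≡1 d)))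

0<s∧d*s∈ℤ⇒s≡n/d : ∀ d .{{_ : ℕ.NonZero d}} {s} → 0ℚ < s → IsInt (ℕ→ℚ d * s) → ∃[ n ] s ≡ + n / d
0<s∧d*s∈ℤ⇒s≡n/d d {s} 0<s (z , d*s≡z) = nonNegative z (d*s≡z⇒s≡z/d d {s} {z} d*s≡z)
  where
  nonNegative : ∀ z → s ≡ z / d → ∃[ n ] s ≡ + n / d
  nonNegative (+ n)    s≡n/d = n , s≡n/d
  nonNegative -[1+ m ] s≡z/d =
    contradiction (a/d<b/d⇒a<b 0ℤ -[1+ m ] d (subst₂ _<_ (sym (0/n≡0 d)) s≡z/d 0<s)) λ ()

partner : (D : ℕ) .{{_ : ℕ.NonZero D}} → ℕ → ℚ
partner D i = + (D ∸ i) / D + ℕ→ℚ (2 ℕ.* i ℕ./ D)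

SumIs1or2 : ℚ → ℚ → Set
SumIs1or2 r s = r + s ≡ 1ℚ ⊎ r + s ≡ ℕ→ℚ 2

n<2⇒n≡0⊎n≡1 : ∀ {n} → n ℕ.< 2 → n ≡ 0 ⊎ n ≡ 1
n<2⇒n≡0⊎n≡1 {0}           _                 = inj₁ refl
n<2⇒n≡0⊎n≡1 {1}           _                 = inj₂ refl
n<2⇒n≡0⊎n≡1 {suc (suc _)} (s≤s (s≤s ()))

i/D+[D∸i]/D+k≡1+k : ∀ D .{{_ : ℕ.NonZero D}} {i} k → i ≤ D →
                    + i / D + (+ (D ∸ i) / D + ℕ→ℚ k) ≡ ℕ→ℚ (suc k)
i/D+[D∸i]/D+k≡1+k D {i} k i≤D = begin
  + i / D + (+ (D ∸ i) / D + ℕ→ℚ k)  ≡⟨ sym (+-assoc (+ i / D) (+ (D ∸ i) / D) (ℕ→ℚ k)) ⟩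
  + i / D + + (D ∸ i) / D + ℕ→ℚ k    ≡⟨ cong (_+ ℕ→ℚ k) (a/d+b/d≡[a+b]/d (+ i) (+ (D ∸ i)) D) ⟩
  + (i ℕ.+ (D ∸ i)) / D + ℕ→ℚ k      ≡⟨ cong (λ m → + m / D + ℕ→ℚ k) (ℕ.m+[n∸m]≡n i≤D) ⟩
  + D / D + ℕ→ℚ k                    ≡⟨ cong (_+ ℕ→ℚ k) (n/n≡1 D) ⟩
  1ℚ + ℕ→ℚ k                         ≡⟨ a/d+b/d≡[a+b]/d (+ 1) (+ k) 1 ⟩
  ℕ→ℚ (suc k)                        ∎
  where open ≡-Reasoning

SumIs1or2-partner : ∀ D .{{_ : ℕ.NonZero D}} {i} → i ℕ.< D → SumIs1or2 (+ i / D) (partner D i)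
SumIs1or2-partner D {i} i<D = Sum.map
  (λ k≡0 → trans sum (cong (ℕ→ℚ ∘ suc) k≡0))
  (λ k≡1 → trans sum (cong (ℕ→ℚ ∘ suc) k≡1))
  (n<2⇒n≡0⊎n≡1 (m<n*o⇒m/o<n (ℕ.*-monoʳ-< 2 i<D)))
  where
  sum : + i / D + partner D i ≡ ℕ→ℚ (suc (2 ℕ.* i ℕ./ D))
  sum = i/D+[D∸i]/D+k≡1+k D (2 ℕ.* i ℕ./ D) (ℕ.<⇒≤ i<D)

InO⇒SumIs1or2 : ∀ D .{{_ : ℕ.NonZero D}} {r s} → InO D r s → SumIs1or2 r s
InO⇒SumIs1or2 D@(suc _) (i , _ , i≤D∸1 , _ , refl , refl) = SumIs1or2-partner D (s≤s i≤D∸1)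

InSomeO⇒SumIs1or2 : ∀ {r s} → InSomeO r s → SumIs1or2 r s
InSomeO⇒SumIs1or2 (inj₁ o)                                 = InO⇒SumIs1or2 24 o
InSomeO⇒SumIs1or2 (inj₂ (inj₁ o))                          = InO⇒SumIs1or2 12 o
InSomeO⇒SumIs1or2 (inj₂ (inj₂ (inj₁ o)))                   = InO⇒SumIs1or2 8 o
InSomeO⇒SumIs1or2 (inj₂ (inj₂ (inj₂ (inj₁ o))))            = InO⇒SumIs1or2 6 o
InSomeO⇒SumIs1or2 (inj₂ (inj₂ (inj₂ (inj₂ (inj₁ o)))))     = InO⇒SumIs1or2 4 o
InSomeO⇒SumIs1or2 (inj₂ (inj₂ (inj₂ (inj₂ (inj₂ o)))))     = InO⇒SumIs1or2 3 o

gcd≢0 : ∀ m n .{{_ : ℕ.NonZero n}} → ℕ.NonZero (gcd m n)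
gcd≢0 m n = ℕ.≢-nonZero (gcd[m,n]≢0 m n (inj₂ (ℕ.≢-nonZero⁻¹ n)))

n/gcd≢0 : ∀ m n .{{_ : ℕ.NonZero n}} → ℕ.NonZero ((n ℕ./ gcd m n) {{gcd≢0 m n}})
n/gcd≢0 m n = ℕ.≢-nonZero (n/gcd[m,n]≢0 m n {{gcd≢0 = gcd≢0 m n}})

InO[N/gcd[j,N]] : ∀ N .{{_ : ℕ.NonZero N}} j → 1 ≤ j → j ℕ.< N →
                  InO ((N ℕ./ gcd j N) {{gcd≢0 j N}}) {{n/gcd≢0 j N}} (+ j / N) (partner N j)
InO[N/gcd[j,N]] N j 1≤j j<N =
  i , 1≤i , ℕ.∸-monoˡ-≤ 1 i<D , coprime⇒gcd≡1 (coprime-/gcd j N) ,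
  trans (cong (λ m → + m / N) j≡i*g) (rescale i) ,
  cong₂ _+_ (trans (cong (λ m → + m / N) N∸j≡[D∸i]*g) (rescale (D ∸ i))) (cong ℕ→ℚ ⌊2j/N⌋≡⌊2i/D⌋)
  where
  g : ℕ
  g = gcd j N
  instance
    _ : ℕ.NonZero g
    _ = gcd≢0 j N

  i D : ℕ
  i = j ℕ./ g
  D = N ℕ./ g
  instance
    _ : ℕ.NonZero D
    _ = n/gcd≢0 j N
    _ : ℕ.NonZero (D ℕ.* g)
    _ = ℕ.m*n≢0 D g

  j≡i*g : j ≡ i ℕ.* g
  j≡i*g = sym (m/n*n≡m (gcd[m,n]∣m j N))

  N≡D*g : N ≡ D ℕ.* g
  N≡D*g = sym (m/n*n≡m (gcd[m,n]∣n j N))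

  N∸j≡[D∸i]*g : N ∸ j ≡ (D ∸ i) ℕ.* g
  N∸j≡[D∸i]*g = trans (cong₂ _∸_ N≡D*g j≡i*g) (sym (ℕ.*-distribʳ-∸ g D i))

  i<D : i ℕ.< D
  i<D = ℕ.*-cancelʳ-< g i D (subst₂ ℕ._<_ j≡i*g N≡D*g j<N)

  1≤i : 1 ≤ i
  1≤i = m≥n⇒m/n>0 (∣⇒≤ {{ℕ.>-nonZero 1≤j}} (gcd[m,n]∣m j N))

  rescale : ∀ a → + (a ℕ.* g) / N ≡ + a / D
  rescale a = m*e≡n*d⇒m/d≡n/e (a ℕ.* g) a N D (trans
    (solve 3 (λ a g D → a :* g :* D := a :* (D :* g)) refl a g D)
    (cong (a ℕ.*_) (sym N≡D*g)))
    where open ℕ-Solver.+-*-Solver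

  ⌊2j/N⌋≡⌊2i/D⌋ : 2 ℕ.* j ℕ./ N ≡ 2 ℕ.* i ℕ./ D
  ⌊2j/N⌋≡⌊2i/D⌋ = trans (/-congˡ (trans (cong (2 ℕ.*_) j≡i*g) (sym (ℕ.*-assoc 2 i g))))
    (trans (/-congʳ N≡D*g) (m*n/o*n≡m/o (2 ℕ.* i) g D))

S₂-numerators : ∀ {r s} c → S₂ r s → r + s ≡ ℕ→ℚ c →
  ∃₂ λ j n → r ≡ + j / 24 × s ≡ + n / 24 × j ℕ.+ n ≡ c ℕ.* 24 × 0 ℕ.< j × j ℕ.< n × n ℕ.< 36
S₂-numerators {r} {s} c (0<r , r<s , s<3/2 , _ , _ , 24s∈ℤ , _) r+s≡c
  with 0<s∧d*s∈ℤ⇒s≡n/d 24 (<-trans 0<r r<s) 24s∈ℤ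
... | n , refl = j , n , r≡j/24 , refl , j+n≡c*24 ,
  <-numerators (subst (0ℚ <_) r≡j/24 0<r) , <-numerators (subst (_< s) r≡j/24 r<s) , <-numerators s<3/2
  where
  <-numerators : ∀ {a b} → + a / 24 < + b / 24 → a ℕ.< b
  <-numerators {a} {b} = ℤ.drop‿+<+ ∘ a/d<b/d⇒a<b (+ a) (+ b) 24

  n<c*24 : n ℕ.< c ℕ.* 24
  n<c*24 = <-numerators (subst₂ _<_ (+-identityˡ s) (trans r+s≡c (ℕ→ℚ≡[m*d]/d c 24)) (+-monoˡ-< s 0<r))

  j : ℕ
  j = c ℕ.* 24 ∸ n

  j+n≡c*24 : j ℕ.+ n ≡ c ℕ.* 24
  j+n≡c*24 = ℕ.m∸n+n≡m (ℕ.<⇒≤ n<c*24)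

  r≡j/24 : r ≡ + j / 24
  r≡j/24 = ∙-cancelʳ s r (+ j / 24) (begin
    r + s              ≡⟨ r+s≡c ⟩
    ℕ→ℚ c              ≡⟨ ℕ→ℚ≡[m*d]/d c 24 ⟩
    + (c ℕ.* 24) / 24  ≡⟨ cong (λ m → + m / 24) (sym j+n≡c*24) ⟩
    + (j ℕ.+ n) / 24   ≡⟨ sym (a/d+b/d≡[a+b]/d (+ j) (+ n) 24) ⟩
    + j / 24 + s       ∎)
    where open ≡-Reasoning

2*j<j+n : ∀ {j n} → j ℕ.< n → 2 ℕ.* j ℕ.< j ℕ.+ n
2*j<j+n {j} j<n = ℕ.+-monoʳ-< j (subst (ℕ._< _) (sym (ℕ.+-identityʳ j)) j<n)

line-numerators : ∀ {c j n} → c ≡ 1 ⊎ c ≡ 2 → j ℕ.+ n ≡ c ℕ.* 24 → j ℕ.< n → n ℕ.< 36 →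
                  j ℕ.< 24 × j ≢ 12 × c ≡ suc (2 ℕ.* j ℕ./ 24)
line-numerators {j = j} (inj₁ refl) j+n≡24 j<n _ =
  ℕ.<-≤-trans j<12 (ℕ.m≤m+n 12 12) , ℕ.<⇒≢ j<12 , cong suc (sym (ℕ.n<1⇒n≡0 (m<n*o⇒m/o<n 2j<24)))
  where
  2j<24 : 2 ℕ.* j ℕ.< 24
  2j<24 = subst (2 ℕ.* j ℕ.<_) j+n≡24 (2*j<j+n j<n)
  j<12 : j ℕ.< 12
  j<12 = ℕ.*-cancelˡ-< 2 j 12 2j<24
line-numerators {j = j} {n} (inj₂ refl) j+n≡48 j<n n<36 =
  ℕ.*-cancelˡ-< 2 j 24 2j<48 , ℕ.>⇒≢ 12<j ,
  cong suc (ℕ.≤-antisym (m≥n⇒m/n>0 (ℕ.*-monoʳ-≤ 2 (ℕ.<⇒≤ 12<j))) (ℕ.≤-pred (m<n*o⇒m/o<n 2j<48)))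
  where
  2j<48 : 2 ℕ.* j ℕ.< 48
  2j<48 = subst (2 ℕ.* j ℕ.<_) j+n≡48 (2*j<j+n j<n)
  12<j : 12 ℕ.< j
  12<j = ℕ.+-cancelʳ-< n 12 j (subst (12 ℕ.+ n ℕ.<_) (sym j+n≡48) (ℕ.+-monoʳ-< 12 n<36))

S₂∧line⇒orbitPair : ∀ {r s} c → c ≡ 1 ⊎ c ≡ 2 → S₂ r s → r + s ≡ ℕ→ℚ c →
  ∃[ j ] 1 ≤ j × j ℕ.< 24 × j ≢ 12 × r ≡ + j / 24 × s ≡ partner 24 j
S₂∧line⇒orbitPair c c≡1⊎c≡2 S r+s≡c with S₂-numerators c S r+s≡c
... | j , n , refl , refl , j+n≡c*24 , 0<j , j<n , n<36 with line-numerators c≡1⊎c≡2 j+n≡c*24 j<n n<36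
... | j<24 , j≢12 , c≡1+k = j , 0<j , j<24 , j≢12 , refl ,
  ∙-cancelˡ (+ j / 24) (+ n / 24) (partner 24 j) (begin
    + j / 24 + + n / 24         ≡⟨ r+s≡c ⟩
    ℕ→ℚ c                       ≡⟨ cong ℕ→ℚ c≡1+k ⟩
    ℕ→ℚ (suc (2 ℕ.* j ℕ./ 24))  ≡⟨ sym (i/D+[D∸i]/D+k≡1+k 24 (2 ℕ.* j ℕ./ 24) (ℕ.<⇒≤ j<24)) ⟩
    + j / 24 + partner 24 j     ∎)
  where open ≡-Reasoning

S₂∧SumIs1or2⇒orbitPair : ∀ {r s} → S₂ r s → SumIs1or2 r s →
  ∃[ j ] 1 ≤ j × j ℕ.< 24 × j ≢ 12 × r ≡ + j / 24 × s ≡ partner 24 j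
S₂∧SumIs1or2⇒orbitPair S (inj₁ r+s≡1) = S₂∧line⇒orbitPair 1 (inj₁ refl) S r+s≡1
S₂∧SumIs1or2⇒orbitPair S (inj₂ r+s≡2) = S₂∧line⇒orbitPair 2 (inj₂ refl) S r+s≡2

Denominators : List ℕ
Denominators = 24 ∷ 12 ∷ 8 ∷ 6 ∷ 4 ∷ 3 ∷ []

InO⇒InSomeO : ∀ {D} .{{_ : ℕ.NonZero D}} {r s} → D ∈ Denominators → InO D r s → InSomeO r s
InO⇒InSomeO (here refl)                                         = inj₁
InO⇒InSomeO (there (here refl))                                 = inj₂ ∘ inj₁
InO⇒InSomeO (there (there (here refl)))                         = inj₂ ∘ inj₂ ∘ inj₁
InO⇒InSomeO (there (there (there (here refl))))                 = inj₂ ∘ inj₂ ∘ inj₂ ∘ inj₁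
InO⇒InSomeO (there (there (there (there (here refl)))))         = inj₂ ∘ inj₂ ∘ inj₂ ∘ inj₂ ∘ inj₁
InO⇒InSomeO (there (there (there (there (there (here refl)))))) = inj₂ ∘ inj₂ ∘ inj₂ ∘ inj₂ ∘ inj₂

24/gcd[j,24]∈Denominators : ∀ j → 1 ≤ j → j ℕ.< 24 → j ≢ 12 →
                            (24 ℕ./ gcd j 24) {{gcd≢0 j 24}} ∈ Denominators
24/gcd[j,24]∈Denominators j 1≤j j<24 j≢12 = toWitness {a? = ℕ.allUpTo? P? 24} _ j<24 1≤j j≢12
  where
  P : ℕ → Set
  P j = 1 ≤ j → j ≢ 12 → (24 ℕ./ gcd j 24) {{gcd≢0 j 24}} ∈ Denominators
  P? : ∀ j → Dec (P j)
  P? j = 1 ℕ.≤? j →-dec (¬? (j ℕ.≟ 12) →-dec (_ ∈? Denominators))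

S₂∧SumIs1or2⇒InSomeO : ∀ {r s} → S₂ r s → SumIs1or2 r s → InSomeO r s
S₂∧SumIs1or2⇒InSomeO S r+s≡1⊎2 with S₂∧SumIs1or2⇒orbitPair S r+s≡1⊎2
... | j , 1≤j , j<24 , j≢12 , refl , refl =
  InO⇒InSomeO {{n/gcd≢0 j 24}} (24/gcd[j,24]∈Denominators j 1≤j j<24 j≢12) (InO[N/gcd[j,N]] 24 j 1≤j j<24)

corollary3p7 : (r s : ℚ) → S₂ r s →
    (InSomeO r s → (r + s ≡ 1ℚ) ⊎ (r + s ≡ ℕ→ℚ 2))
    × ((r + s ≡ 1ℚ) ⊎ (r + s ≡ ℕ→ℚ 2) → InSomeO r s)
corollary3p7 r s S = InSomeO⇒SumIs1or2 , S₂∧SumIs1or2⇒InSomeO S
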